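{- Let $\langle X,\mathcal{T},R\rangle$ be an $\mathcal{S}$-monotonic $DS$-space. Then the specialization dual order $\le\ \subseteq X\times X$ is a monotonic meet-relation (from $\langle X,\mathcal{T},R\rangle$ to itself).
   Context: For a topological space $X$: the specialization dual order is $x\le y$ iff $y\in\mathrm{Cl}(\{x\})$. $\mathcal{KO}(X)$ compact open subsets, $D(X)=\{U:X-U\in\mathcal{KO}(X)\}$, $\mathcal{S}(X)$ the set of all $\bigcap\mathcal{L}$ for dually directed (under inclusion) $\mathcal{L}\subseteq\mathcal{KO}(X)$. A $DS$-space is one in which $\mathcal{KO}(X)$ is a basis and which is sober. For $R\subseteq X\times\mathcal{S}(X)$: $R(x)=\{Z:(x,Z)\in R\}$, $m_R(U)=\{x:\forall Z\in R(x)\,(Z\cap U\ne\emptyset)\}$, $L_U=\{Z\in\mathcal{S}(X):Z\cap U\ne\emptyset\}$. An $\mathcal{S}$-monotonic $DS$-space is a $DS$-space with $R\subseteq X\times\mathcal{S}(X)$ such that $m_R(U)\in D(X)$ for $U\in D(X)$ and $R(x)=\bigcap\{L_U:U\in D(X),x\in m_R(U)\}$. For $S\subseteq X\times X$: $S(x)=\{y:(x,y)\in S\}$, $h_S(U)=\{x:S(x)\subseteq U\}$, $S^{ -1}[W]=\{x:\exists y\in W,(x,y)\in S\}$. A meet-relation is $S$ with $h_S(U)\in D(X)$ for $U\in D(X)$ and $S(x)=\bigcap\{U\in D(X):S(x)\subseteq U\}$ for all $x$. A monotonic meet-relation is a meet-relation $S$ such that for all $x\in X$ and $U\in D(X)$: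 $X-U\in R[S(x)]$ iff $S^{ -1}[X-U]\in R(x)$, where $R[S(x)]=\{Z\in\mathcal{S}(X):\exists y\in S(x),(y,Z)\in R\}$. -}

module Defs where

open import Level using (Level; _⊔_) renaming (zero to 0ℓ; suc to lsuc)
open import Data.Product using (Σ; ∃; ∃-syntax; _×_; _,_)
open import Data.Sum using (_⊎_)
open import Data.Unit using (⊤)
open import Data.List using (List)
open import Data.List.Relation.Unary.Any using (Any)
open import Relation.Binary.PropositionalEquality using (_≡_)
open import Relation.Unary using (Pred; _⊆_; _≐_; ∁; _∩_; _∪_)

_iff_ : ∀ {a b} → Set a → Set b → Set (a ⊔ b)
A iff B = (A → B) × (B → A)

Subset : Set → Set₁
Subset X = Pred X 0ℓ

record Topology (X : Set) : Set₁ where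
  field
    Open      : Subset X → Set
    Open-resp : ∀ {U V : Subset X} → U ≐ V → Open U → Open V
    Open-univ : Open (λ _ → ⊤)
    Open-∩    : ∀ {U V : Subset X} → Open U → Open V → Open (U ∩ V)
    Open-⋃    : (I : Set) (U : I → Subset X) → (∀ i → Open (U i)) →
                Open (λ x → Σ I (λ i → U i x))

module _ {X : Set} (τ : Topology X) where
  open Topology τ

  ⋃ᶠ : {I : Set} → (I → Subset X) → Subset X
  ⋃ᶠ {I} U x = Σ I (λ i → U i x)

  ⋂ᶠ : {I : Set} → (I → Subset X) → Subset X
  ⋂ᶠ {I} U x = (i : I) → U i x

  Compact : Subset X → Set₁
  Compact K = (I : Set) (U : I → Subset X) → (∀ i → Open (U i)) →
              K ⊆ ⋃ᶠ U → Σ (List I) (λ is → K ⊆ (λ x → Any (λ i → U i x) is))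

  KO : Subset X → Set₁
  KO U = Open U × Compact U

  D : Subset X → Set₁
  D U = KO (∁ U)

  -- membership in D(X) of a subset given by a predicate of arbitrary level
  -- (it is extensionally equal to some U ∈ D(X))
  InD : ∀ {ℓ} → Pred X ℓ → Set (lsuc 0ℓ ⊔ ℓ)
  InD P = Σ (Subset X) (λ V → (V ≐ P) × D V)

  Closed : Subset X → Set
  Closed C = Open (∁ C)

  Cl : ∀ {ℓ} → Pred X ℓ → Pred X (lsuc 0ℓ ⊔ ℓ)
  Cl A x = (U : Subset X) → Open U → U x → Σ X (λ y → A y × U y)

  singleton : X → Subset X
  singleton x = λ y → x ≡ y

  _≤ₛ_ : X → X → Set₁
  x ≤ₛ y = Cl (singleton x) y

  KOBasis : Set₁
  KOBasis = (U : Subset X) → Open U → (x : X) → U x →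
            Σ (Subset X) (λ V → KO V × V x × V ⊆ U)

  Irreducible : Subset X → Set₁
  Irreducible C = Σ X C ×
    ((C₁ C₂ : Subset X) → Closed C₁ → Closed C₂ → C ⊆ (C₁ ∪ C₂) →
       (C ⊆ C₁) ⊎ (C ⊆ C₂))

  Sober : Set₁
  Sober = (C : Subset X) → Closed C → Irreducible C →
          Σ X (λ x → (C ≐ Cl (singleton x)) ×
                     ((y : X) → C ≐ Cl (singleton y) → y ≡ x))

  record IsDSSpace : Set₁ where
    field
      basis : KOBasis
      sober : Sober

  -- 𝒮(X): intersections of dually directed (nonempty) families in 𝒦𝒪(X)
  𝒮 : Subset X → Set₁
  𝒮 Z = Σ Set (λ I → Σ (I → Subset X) (λ L →
          ((i : I) → KO (L i)) × I ×
          ((i j : I) → Σ I (λ k → L k ⊆ (L i ∩ L j))) ×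
          (Z ≐ ⋂ᶠ L)))

  -- L_U = { Z ∈ 𝒮(X) : Z ∩ U ≠ ∅ }  (membership of Z, given Z ∈ 𝒮(X))
  Meets : ∀ {ℓ} → Subset X → Pred X ℓ → Set ℓ
  Meets Z U = Σ X (λ y → Z y × U y)

  module _ (R : X → Subset X → Set) where

    m : ∀ {ℓ} → Pred X ℓ → Pred X (lsuc 0ℓ ⊔ ℓ)
    m U x = (Z : Subset X) → R x Z → Meets Z U

    record IsSMonotonic : Set₁ where
      field
        R⊆𝒮   : (x : X) (Z : Subset X) → R x Z → 𝒮 Z
        m-D   : (U : Subset X) → D U → InD (m U)
        R-int : (x : X) (Z : Subset X) →
                R x Z iff (𝒮 Z × ((U : Subset X) → D U → m U x → Meets Z U))

    module _ {ℓ} (S : X → X → Set ℓ) where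

      h : Subset X → Pred X ℓ
      h U x = S x ⊆ U

      inv : Subset X → Pred X ℓ
      inv W x = Σ X (λ y → S x y × W y)

      record IsMeetRelation : Set (lsuc (lsuc 0ℓ ⊔ ℓ)) where
        field
          h-D   : (U : Subset X) → D U → InD (h U)
          S-int : (x : X) → S x ≐ (λ y → (U : Subset X) → D U → S x ⊆ U → U y)

      RImg : X → Subset X → Set (lsuc 0ℓ ⊔ ℓ)
      RImg x Z = 𝒮 Z × Σ X (λ y → S x y × R y Z)

      -- a (possibly large) predicate P, as a subset, belongs to R(x)
      InR : ∀ {k} → X → Pred X k → Set (lsuc 0ℓ ⊔ k)
      InR x P = Σ (Subset X) (λ V → (V ≐ P) × R x V)

      record IsMonotonicMeetRelation : Set (lsuc (lsuc 0ℓ ⊔ ℓ)) where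
        field
          meet : IsMeetRelation
          mono : (x : X) (U : Subset X) → D U →
                 RImg x (∁ U) iff InR x (inv (∁ U))

module Submission where

open import Defs
open import Axiom.ExcludedMiddle using (ExcludedMiddle)
open import Axiom.DoubleNegationElimination using (em⇒dne)
open import Level using (0ℓ)
open import Data.Product using (Σ; _×_; _,_; proj₁; proj₂)
open import Data.Empty using (⊥-elim)
open import Relation.Nullary using (yes; no)
open import Relation.Binary.PropositionalEquality using (refl)
open import Relation.Unary using (_⊆_; _≐_; ∁)
open import Relation.Unary.Properties using (≐-sym; ≐-trans)

-- Every set of D(X) is closed, hence an up-set of ≤ₛ, while every open set is a
-- down-set.  So h_≤ fixes D(X) and ≤⁻¹ fixes the compact opens X - U, which
-- reduces the monotonicity condition to: R(y) ⊆ R(x) whenever x ≤ y.  That holds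
-- because each m_R(U) lies in D(X), so is an up-set, and R(x) is determined by
-- the sets m_R(U) containing x.  Finally ↑x is an intersection of sets in D(X)
-- because the compact opens form a basis: a basic V ∋ y missing x gives X - V.

module _ {X : Set} (τ : Topology X) where
  open Topology τ

  ≤ₛ-refl : ∀ x → _≤ₛ_ τ x x
  ≤ₛ-refl x _ _ Ux = x , refl , Ux

  Open⇒≤ₛ-downClosed : ∀ {O} → Open O → ∀ {x y} → _≤ₛ_ τ x y → O y → O x
  Open⇒≤ₛ-downClosed oO x≤y Oy with x≤y _ oO Oy
  ... | _ , refl , Ox = Ox

  Open⇒≤ₛ-downClosure≐ : ∀ {O} → Open O →
                          (λ x → Σ X (λ y → _≤ₛ_ τ x y × O y)) ≐ O
  Open⇒≤ₛ-downClosure≐ oO =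
    (λ (_ , x≤y , Oy) → Open⇒≤ₛ-downClosed oO x≤y Oy) ,
    (λ {x} Ox → x , ≤ₛ-refl x , Ox)

  KO-resp-≐ : ∀ {A B} → A ≐ B → KO τ A → KO τ B
  KO-resp-≐ (A⊆B , B⊆A) (oA , cA) =
    Open-resp (A⊆B , B⊆A) oA ,
    λ I U oU B⊆⋃U → let (is , A⊆⋃is) = cA I U oU (λ a → B⊆⋃U (A⊆B a))
                    in is , λ b → A⊆⋃is (B⊆A b)

  𝒮-resp-≐ : ∀ {A B} → A ≐ B → 𝒮 τ A → 𝒮 τ B
  𝒮-resp-≐ A≐B (I , L , kos , i , directed , A≐⋂L) =
    I , L , kos , i , directed , ≐-trans (≐-sym A≐B) A≐⋂L

  module _ (lem : ExcludedMiddle 0ℓ) where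

    Closed⇒≤ₛ-upClosed : ∀ {C} → Closed τ C → ∀ {x y} → _≤ₛ_ τ x y → C x → C y
    Closed⇒≤ₛ-upClosed oC x≤y Cx =
      em⇒dne lem (λ ¬Cy → Open⇒≤ₛ-downClosed oC x≤y ¬Cy Cx)

    Closed⇒≤ₛ-upperSet≐ : ∀ {C} → Closed τ C → (λ x → _≤ₛ_ τ x ⊆ C) ≐ C
    Closed⇒≤ₛ-upperSet≐ oC =
      (λ {x} ↑x⊆C → ↑x⊆C (≤ₛ-refl x)) ,
      (λ Cx x≤y → Closed⇒≤ₛ-upClosed oC x≤y Cx)

    KO⇒∁∈D : ∀ {V} → KO τ V → D τ (∁ V)
    KO⇒∁∈D = KO-resp-≐ ((λ v ¬v → ¬v v) , em⇒dne lem)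

    ≤ₛ-fromD : KOBasis τ → ∀ x y →
               ((U : Subset X) → D τ U → _≤ₛ_ τ x ⊆ U → U y) → _≤ₛ_ τ x y
    ≤ₛ-fromD basis x y y∈⋂D O oO Oy with basis O oO y Oy
    ... | V , koV , Vy , V⊆O with lem {V x}
    ...   | yes Vx = x , refl , V⊆O Vx
    ...   | no ¬Vx = ⊥-elim (y∈⋂D (∁ V) (KO⇒∁∈D koV) ↑x⊆∁V Vy)
      where
      ↑x⊆∁V : _≤ₛ_ τ x ⊆ ∁ V
      ↑x⊆∁V x≤z Vz = ¬Vx (Open⇒≤ₛ-downClosed (proj₁ koV) x≤z Vz)

    module _ {R : X → Subset X → Set} (sm : IsSMonotonic τ R) where
      open IsSMonotonic sm

      R-resp-≐ : ∀ {x V W} → V ≐ W → R x V → R x W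
      R-resp-≐ {x} {V} {W} V≐W RxV with proj₁ (R-int x V) RxV
      ... | 𝒮V , V-meets-m = proj₂ (R-int x W) (𝒮-resp-≐ V≐W 𝒮V , W-meets-m)
        where
        W-meets-m : (U : Subset X) → D τ U → m τ R U x → Meets τ W U
        W-meets-m U dU mx with V-meets-m U dU mx
        ... | z , Vz , Uz = z , proj₁ V≐W Vz , Uz

      m-upClosed : ∀ {U} → D τ U → ∀ {x y} → _≤ₛ_ τ x y → m τ R U x → m τ R U y
      m-upClosed dU x≤y mx with m-D _ dU
      ... | V , (V⊆m , m⊆V) , dV =
        V⊆m (Closed⇒≤ₛ-upClosed (proj₁ dV) x≤y (m⊆V mx))

      R-antitone : ∀ {x y Z} → _≤ₛ_ τ x y → R y Z → R x Z
      R-antitone {x} {y} {Z} x≤y RyZ with proj₁ (R-int y Z) RyZ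
      ... | 𝒮Z , Z-meets-m =
        proj₂ (R-int x Z) (𝒮Z , λ U dU mx → Z-meets-m U dU (m-upClosed dU x≤y mx))

mainTheorem12 : (lem : ∀ {ℓ} → ExcludedMiddle ℓ) →
                (X : Set) (τ : Topology X) → IsDSSpace τ →
                (R : X → Subset X → Set) → IsSMonotonic τ R →
                IsMonotonicMeetRelation τ R (_≤ₛ_ τ)
mainTheorem12 lem X τ ds R sm = record
  { meet = record
    { h-D   = λ U dU → U , ≐-sym (Closed⇒≤ₛ-upperSet≐ τ lem (proj₁ dU)) , dU
    ; S-int = λ x → (λ x≤y _ _ ↑x⊆U → ↑x⊆U x≤y) , λ {y} → ≤ₛ-fromD τ lem basis x y
    }
  ; mono = λ x U dU →
      let ≤⁻¹[∁U]≐∁U = Open⇒≤ₛ-downClosure≐ τ (proj₁ dU) in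
      (λ (_ , y , x≤y , Ry∁U) → ∁ U , ≐-sym ≤⁻¹[∁U]≐∁U , R-antitone τ lem sm x≤y Ry∁U) ,
      (λ (V , V≐≤⁻¹[∁U] , RxV) →
         let Rx∁U = R-resp-≐ τ lem sm (≐-trans V≐≤⁻¹[∁U] ≤⁻¹[∁U]≐∁U) RxV
         in R⊆𝒮 sm x (∁ U) Rx∁U , x , ≤ₛ-refl τ x , Rx∁U)
  }
  where
  open IsDSSpace ds
  open IsSMonotonic using (R⊆𝒮)
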